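{- Let $\mathbb{R}$ and $\mathbb{T}$ be algebraic theories, let $\mathcal{S}$ be an $\mathbb{R}$-residual $\mathbb{T}$-comodel with state set $S$, and let $\sim$ be an $\mathbb{R}$-bisimulation on $\mathcal{R}(S)$. Then there is a unique structure of $\mathbb{R}$-$\mathbb{T}$-bimodel on the quotient $\mathbb{R}$-model $\mathcal{K}=\mathcal{R}(S)/\!\sim$ for which the quotient map $q\colon\mathcal{R}(S)\twoheadrightarrow\mathcal{K}$ is a map of bimodels from the bimodel $\mathcal{R}(\mathcal{S})$ associated to $\mathcal{S}$ to $\mathcal{K}$.
   Context: An algebraic theory consists of a signature (function symbols $\sigma$ with arity sets $|\sigma|$) and equations between terms; $R(V)$ denotes the set of $\mathbb{R}$-terms in variables $V$ modulo the theory's equations, which carries the free $\mathbb{R}$-model $\mathcal{R}(V)$ on $V$. For $f\colon V\to R(W)$, $f^\dagger\colon\mathcal{R}(V)\to\mathcal{R}(W)$ is the unique homomorphism extending $f$ (substitution). An $\mathbb{R}$-residual $\mathbb{T}$-comodel is a set $S$ with functions $[\![\sigma]\!]^{\mathcal{S}}\colon S\to R(|\sigma|\times S)$ for each $\mathbb{T}$-symbol $\sigma$, such that the derived co-operations $[\![t]\!]^{\mathcal{S}}\colon S\to R(V\times S)$, defined by $[\![v]\!](s)=(v,s)$ and $[\![\sigma(t)]\!](s)=[\![\sigma]\!](s)\bigl(\lambda(i,s').\,[\![t_i]\!](s')\bigr)$, satisfy $[\![t]\!]=[\![u]\!]$ for every equation $t=u$ of $\mathbb{T}$ (i.e. it is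 a $\mathbb{T}$-comodel in the Kleisli category of $\mathbb{R}$). The category $\mathbf{Mod}(\mathbb{R})$ of $\mathbb{R}$-models in $\mathbf{Set}$ has copowers; for free models we take $B\cdot\mathcal{R}(V)=\mathcal{R}(B\times V)$ with $b$-th coprojection induced by $v\mapsto(b,v)$. An $\mathbb{R}$-$\mathbb{T}$-bimodel is an $\mathbb{R}$-model $\mathcal{K}$ with a $\mathbb{T}$-comodel structure in $\mathbf{Mod}(\mathbb{R})$: $\mathbb{R}$-homomorphisms $[\![\sigma]\!]^{\mathcal{K}}\colon\mathcal{K}\to|\sigma|\cdot\mathcal{K}$ satisfying the equations of $\mathbb{T}$ in $\mathbf{Mod}(\mathbb{R})^{\mathrm{op}}$. A map of bimodels is an $\mathbb{R}$-homomorphism $h$ with $[\![\sigma]\!]^{\mathcal{K}'}\circ h=(|\sigma|\cdot h)\circ[\![\sigma]\!]^{\mathcal{K}}$ for all $\sigma$. The bimodel $\mathcal{R}(\mathcal{S})$ associated to $\mathcal{S}$ has underlying model $\mathcal{R}(S)$ and co-operations $([\![\sigma]\!]^{\mathcal{S}})^\dagger\colon\mathcal{R}(S)\to\mathcal{R}(|\sigma|\times S)$. For an $\mathbb{R}$-congruence $\sim$ on $\mathcal{R}(V)$ and a set $B$, $\sim_B$ is the congruence on $\mathcal{R}(B\times V)$ generated by $t(\lambda v.(b,v))\sim_B u(\lambda v.(b,v))$ whenever $t\sim u$ and $b\in B$. A congruence $\sim$ on $\mathcal{R}(S)$ is an $\mathbb{R}$-bisimulation for $\mathcal{S}$ if each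 $([\![\sigma]\!]^{\mathcal{S}})^\dagger$ sends $\sim$-related terms to $\sim_{|\sigma|}$-related terms. -}

module Defs where

open import Data.Product using (Σ; _×_; _,_; proj₁; proj₂)
open import Data.Empty using (⊥)
open import Relation.Binary.PropositionalEquality using (_≡_)

record Signature : Set₁ where
  field
    Sym : Set
    ar  : Sym → Set

data Term (Σg : Signature) (V : Set) : Set where
  var : V → Term Σg V
  op  : (σ : Signature.Sym Σg) → (Signature.ar Σg σ → Term Σg V) → Term Σg V

-- Substitution t(f) ; f† on free models is  λ t → subst t f
subst : {Σg : Signature} {V W : Set} → Term Σg V → (V → Term Σg W) → Term Σg W
subst (var v)   f = f v
subst (op σ ts) f = op σ (λ i → subst (ts i) f)

rename : {Σg : Signature} {V W : Set} → (V → W) → Term Σg V → Term Σg W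
rename g t = subst t (λ v → var (g v))

record Theory : Set₁ where
  field
    sig     : Signature
    Ax      : Set
    AxVars  : Ax → Set
    lhs rhs : (a : Ax) → Term sig (AxVars a)
  open Signature sig public

open Theory

TermOf : Theory → Set → Set
TermOf R V = Term (sig R) V

-- R-congruences on the free model R(V) (presented on raw terms: they
-- contain all instances of the equations of R, so they are exactly the
-- congruences on R(V) = terms modulo the equations of R)

record IsCongruence (R : Theory) {V : Set}
                    (_∼_ : TermOf R V → TermOf R V → Set) : Set where
  field
    refl′   : ∀ {t} → t ∼ t
    sym′    : ∀ {t u} → t ∼ u → u ∼ t
    trans′  : ∀ {t u w} → t ∼ u → u ∼ w → t ∼ w
    cong-op : ∀ (ρ : Sym R) {ts us : ar R ρ → TermOf R V}
              → (∀ i → ts i ∼ us i) → op ρ ts ∼ op ρ us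
    axiom   : ∀ (a : Ax R) (f : AxVars R a → TermOf R V)
              → subst (lhs R a) f ∼ subst (rhs R a) f

data Gen (R : Theory) {V : Set} (Base : TermOf R V → TermOf R V → Set)
         : TermOf R V → TermOf R V → Set where
  base    : ∀ {t u} → Base t u → Gen R Base t u
  refl′   : ∀ {t} → Gen R Base t t
  sym′    : ∀ {t u} → Gen R Base t u → Gen R Base u t
  trans′  : ∀ {t u w} → Gen R Base t u → Gen R Base u w → Gen R Base t w
  cong-op : ∀ (ρ : Sym R) {ts us : ar R ρ → TermOf R V}
            → (∀ i → Gen R Base (ts i) (us i)) → Gen R Base (op ρ ts) (op ρ us)
  axiom   : ∀ (a : Ax R) (f : AxVars R a → TermOf R V)
            → Gen R Base (subst (lhs R a) f) (subst (rhs R a) f)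

data Empty {A : Set} : A → A → Set where

-- equality in R(V): provable equality of terms
ProvEq : (R : Theory) {V : Set} → TermOf R V → TermOf R V → Set
ProvEq R = Gen R Empty

data InjRel (R : Theory) {V : Set} (B : Set)
            (_∼_ : TermOf R V → TermOf R V → Set)
            : TermOf R (B × V) → TermOf R (B × V) → Set where
  inj : ∀ (b : B) {t u} → t ∼ u
        → InjRel R B _∼_ (rename (λ v → (b , v)) t) (rename (λ v → (b , v)) u)

Lift : (R : Theory) {V : Set} (B : Set)
       → (TermOf R V → TermOf R V → Set)
       → TermOf R (B × V) → TermOf R (B × V) → Set
Lift R B _∼_ = Gen R (InjRel R B _∼_)

module _ (R T : Theory) (S : Set) where

  coop : (δ : (σ : Sym T) → S → TermOf R (ar T σ × S))
         → {V : Set} → TermOf T V → S → TermOf R (V × S)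
  coop δ (var v)   s = var (v , s)
  coop δ (op σ ts) s = subst (δ σ s) (λ p → coop δ (ts (proj₁ p)) (proj₂ p))

  record ResidualComodel : Set where
    field
      δ   : (σ : Sym T) → S → TermOf R (ar T σ × S)
      law : ∀ (a : Ax T) (s : S)
            → ProvEq R (coop δ (lhs T a) s) (coop δ (rhs T a) s)

  open ResidualComodel

  record IsBisimulation (𝒮 : ResidualComodel)
                        (_∼_ : TermOf R S → TermOf R S → Set) : Set where
    field
      congruence : IsCongruence R _∼_
      preserve   : ∀ (σ : Sym T) {t u : TermOf R S} → t ∼ u
                   → Lift R (ar T σ) _∼_ (subst t (δ 𝒮 σ)) (subst u (δ 𝒮 σ))

  -- Elements of K are represented by terms of R(S); the copower B·K is
  -- represented as R(B × S)/∼_B (with b-th coprojection induced by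
  -- s ↦ (b , s)).  An R-homomorphism K → B·K is a function on
  -- representatives respecting the congruences and the operations.

  module _ (_∼_ : TermOf R S → TermOf R S → Set) where

    -- derived co-operations of K in Mod(R)^op: ⟦v⟧ is the v-th
    -- coprojection, ⟦σ(t)⟧ = [⟦t_i⟧]_i ∘ ⟦σ⟧ with copairing [g_i]_i
    -- the homomorphism induced on generators by (i , s) ↦ g_i [s].
    bcoop : (κ : (σ : Sym T) → TermOf R S → TermOf R (ar T σ × S))
            → {V : Set} → TermOf T V → TermOf R S → TermOf R (V × S)
    bcoop κ (var v)   x = rename (λ s → (v , s)) x
    bcoop κ (op σ ts) x =
      subst (κ σ x) (λ p → bcoop κ (ts (proj₁ p)) (var (proj₂ p)))

    record BimodelStructure : Set where
      field
        κ        : (σ : Sym T) → TermOf R S → TermOf R (ar T σ × S)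
        respects : ∀ (σ : Sym T) {t u} → t ∼ u
                   → Lift R (ar T σ) _∼_ (κ σ t) (κ σ u)
        hom      : ∀ (σ : Sym T) (ρ : Sym R) (ts : ar R ρ → TermOf R S)
                   → Lift R (ar T σ) _∼_ (κ σ (op ρ ts)) (op ρ (λ i → κ σ (ts i)))
        law      : ∀ (a : Ax T) (x : TermOf R S)
                   → Lift R (AxVars T a) _∼_ (bcoop κ (lhs T a) x) (bcoop κ (rhs T a) x)

    open BimodelStructure

    -- the quotient map q : R(S) → K is a map of bimodels R(𝒮) → K:
    -- ⟦σ⟧^K ∘ q = (|σ|·q) ∘ (⟦σ⟧^𝒮)†  (|σ|·q is the quotient map
    -- R(|σ| × S) → R(|σ| × S)/∼_|σ|, the identity on representatives)
    QuotientIsBimodelMap : ResidualComodel → BimodelStructure → Set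
    QuotientIsBimodelMap 𝒮 K =
      ∀ (σ : Sym T) (t : TermOf R S)
      → Lift R (ar T σ) _∼_ (κ K σ t) (subst t (δ 𝒮 σ))

    SameStructure : BimodelStructure → BimodelStructure → Set
    SameStructure K K′ =
      ∀ (σ : Sym T) (t : TermOf R S) → Lift R (ar T σ) _∼_ (κ K σ t) (κ K′ σ t)

{-# OPTIONS --safe #-}
module Submission where

-- The bimodel map condition forces ⟦σ⟧^K [t] = [(⟦σ⟧^𝒮)† t], which gives uniqueness.
-- For existence, (⟦σ⟧^𝒮)† is well defined on K exactly because ∼ is a bisimulation,
-- it is a homomorphism by construction, and the equations of T hold because the
-- derived co-operations of R(𝒮) are the substitution extensions of those of 𝒮,
-- which satisfy the equations of T since 𝒮 is a comodel.

open import Defs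
open import Data.Product using (Σ; _×_; _,_; proj₁; proj₂)

module _ {R : Theory} where

  provEq⇒gen : ∀ {V} {Base : TermOf R V → TermOf R V → Set} {t u}
               → ProvEq R t u → Gen R Base t u
  provEq⇒gen refl′          = refl′
  provEq⇒gen (sym′ p)       = sym′ (provEq⇒gen p)
  provEq⇒gen (trans′ p q)   = trans′ (provEq⇒gen p) (provEq⇒gen q)
  provEq⇒gen (cong-op ρ ps) = cong-op ρ (λ i → provEq⇒gen (ps i))
  provEq⇒gen (axiom a f)    = axiom a f

  subst-congʳ : ∀ {V W} {Base : TermOf R W → TermOf R W → Set}
                (x : TermOf R V) {f g : V → TermOf R W}
                → (∀ v → Gen R Base (f v) (g v))
                → Gen R Base (subst x f) (subst x g)
  subst-congʳ (var v)   f∼g = f∼g v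
  subst-congʳ (op ρ ts) f∼g = cong-op ρ (λ i → subst-congʳ (ts i) f∼g)

  subst-subst : ∀ {U V W} {Base : TermOf R W → TermOf R W → Set}
                (x : TermOf R U) (f : U → TermOf R V) (g : V → TermOf R W)
                → Gen R Base (subst (subst x f) g) (subst x (λ s → subst (f s) g))
  subst-subst (var v)   f g = refl′
  subst-subst (op ρ ts) f g = cong-op ρ (λ i → subst-subst (ts i) f g)

module _ (R T : Theory) (S : Set) (𝒮 : ResidualComodel R T S)
         (_∼_ : TermOf R S → TermOf R S → Set) where
  open Theory
  open ResidualComodel 𝒮

  δ† : (σ : Sym T) → TermOf R S → TermOf R (ar T σ × S)
  δ† σ t = subst t (δ σ)

  bcoop-δ†≈coop† : ∀ {V} {Base : TermOf R (V × S) → TermOf R (V × S) → Set}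
                   (t : TermOf T V) (x : TermOf R S)
                   → Gen R Base (bcoop R T S _∼_ δ† t x) (subst x (coop R T S δ t))
  bcoop-δ†≈coop† (var v)   x = refl′
  bcoop-δ†≈coop† (op σ ts) x = trans′
    (subst-congʳ (δ† σ x) (λ p → bcoop-δ†≈coop† (ts (proj₁ p)) (var (proj₂ p))))
    (subst-subst x (δ σ) _)

  bcoop-δ†-law : ∀ (a : Ax T) (x : TermOf R S)
                 → Lift R (AxVars T a) _∼_ (bcoop R T S _∼_ δ† (lhs T a) x)
                                           (bcoop R T S _∼_ δ† (rhs T a) x)
  bcoop-δ†-law a x = trans′ (bcoop-δ†≈coop† (lhs T a) x)
    (trans′ (subst-congʳ x (λ s → provEq⇒gen (law a s)))
            (sym′ (bcoop-δ†≈coop† (rhs T a) x)))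

  quotientBimodel : IsBisimulation R T S 𝒮 _∼_ → BimodelStructure R T S _∼_
  quotientBimodel bis = record
    { κ        = δ†
    ; respects = IsBisimulation.preserve bis
    ; hom      = λ σ ρ ts → refl′
    ; law      = bcoop-δ†-law
    }

lemma5p3 : (R T : Theory) (S : Set) (𝒮 : ResidualComodel R T S)
           (_∼_ : TermOf R S → TermOf R S → Set)
           → IsBisimulation R T S 𝒮 _∼_
           → Σ (BimodelStructure R T S _∼_)
               (λ K → QuotientIsBimodelMap R T S _∼_ 𝒮 K
                      × (∀ (K′ : BimodelStructure R T S _∼_)
                         → QuotientIsBimodelMap R T S _∼_ 𝒮 K′
                         → SameStructure R T S _∼_ K K′))
lemma5p3 R T S 𝒮 _∼_ bis =
    quotientBimodel R T S 𝒮 _∼_ bis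
  , (λ σ t → refl′)
  , (λ K′ q′ σ t → sym′ (q′ σ t))
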